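{- Let $\varphi$ be a propositional formula in 3-CNF and let $(\mathcal{T},(X,E),k)$ be the instance of OptPDVC with generalized viability constraints constructed from $\varphi$ as in the context. Then $\varphi$ is satisfiable if and only if there exists a viable set $A\subseteq X$ with $|A|\leq k$ and $\mathrm{PD}(A)>0$.
   Context: Phylogenetic diversity: for a rooted tree $\mathcal{T}$ with root $r$, leaf set $X$ and non-negative edge weights, $\mathrm{PD}(S)$ for $S\subseteq X$ is the total weight of the edges of the minimal subtree spanning $S\cup\{r\}$. Let $\varphi$ be a 3-CNF formula over variables $\mathcal{X}=\{x_1,\dots,x_n\}$ with clauses $c_1,\dots,c_m$. Construction: $X=\{c_1,\dots,c_m\}\cup\{x,\bar x,c_x : x\in\mathcal{X}\}\cup\{t\}$; $\mathcal{T}$ is the star with root $r$ and an edge $(r,s)$ for each $s\in X$, of weight $1$ if $s=t$ and $0$ otherwise; food web edges $E=\{(c_x,x),(c_x,\bar x) : x\in\mathcal{X}\}\cup\{(c_i,x): x\in c_i\}\cup\{(c_i,\bar x): \neg x\in c_i\}\cup\{(t,c_i),(t,c_x): 1\leq i\leq m,\ x\in\mathcal{X}\}$; $k=2|\mathcal{X}|+m+1$. A set $S\subseteq X$ is viable if (i) every $s\in S$ is a sink or has some $s'\in S$ with $(s,s')\in E$, and (ii) if $t\in S$ then every $s'$ with $(t,s')\in E$ lies in $S$. -}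

module Defs where

open import Data.Nat using (ℕ; _+_; _*_; _≤_; _<_)
open import Data.Fin using (Fin)
open import Data.Bool using (Bool; true; false)
open import Data.Vec using (Vec)
open import Data.List using (List; length; map)
open import Data.Nat.ListAction using (sum)
open import Data.List.Membership.Propositional using (_∈_)
open import Data.List.Relation.Unary.Unique.Propositional using (Unique)
import Data.Vec.Membership.Propositional as VecMem
open import Data.Product using (Σ; _×_; _,_; proj₁; proj₂; ∃; ∃-syntax)
open import Data.Sum using (_⊎_)
open import Relation.Nullary using (¬_)
open import Relation.Binary.PropositionalEquality using (_≡_)

-- A literal over variables Fin n: (variable , sign); sign true = positive x, false = ¬x.
Literal : ℕ → Set
Literal n = Fin n × Bool

CNF3 : ℕ → ℕ → Set
CNF3 n m = Fin m → Vec (Literal n) 3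

Satisfiable : ∀ {n m} → CNF3 n m → Set
Satisfiable {n} {m} φ =
  Σ (Fin n → Bool) λ α →
    (i : Fin m) → ∃[ ℓ ] (VecMem._∈_ ℓ (φ i) × (α (proj₁ ℓ) ≡ proj₂ ℓ))

data Species (n m : ℕ) : Set where
  clause : Fin m → Species n m
  pos    : Fin n → Species n m
  neg    : Fin n → Species n m
  cvar   : Fin n → Species n m
  t      : Species n m

data Edge {n m : ℕ} (φ : CNF3 n m) : Species n m → Species n m → Set where
  cx-pos  : ∀ x → Edge φ (cvar x) (pos x)
  cx-neg  : ∀ x → Edge φ (cvar x) (neg x)
  ci-pos  : ∀ i x → VecMem._∈_ (x , true) (φ i) → Edge φ (clause i) (pos x)
  ci-neg  : ∀ i x → VecMem._∈_ (x , false) (φ i) → Edge φ (clause i) (neg x)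
  t-ci    : ∀ i → Edge φ t (clause i)
  t-cx    : ∀ x → Edge φ t (cvar x)

Sink : ∀ {n m} (φ : CNF3 n m) → Species n m → Set
Sink φ s = ∀ s' → ¬ Edge φ s s'

-- Generalized viability of a set A ⊆ X (represented as a duplicate-free list).
Viable : ∀ {n m} (φ : CNF3 n m) → List (Species n m) → Set
Viable φ A =
  (∀ s → s ∈ A → Sink φ s ⊎ ∃[ s' ] (s' ∈ A × Edge φ s s'))
  × (t ∈ A → ∀ s' → Edge φ t s' → s' ∈ A)

-- Weight of the edge (r , s) of the star tree T: 1 for t, 0 otherwise.
weight : ∀ {n m} → Species n m → ℕ
weight t = 1
weight _ = 0

-- PD on a star tree: total weight of the edges (r , s) for s ∈ A
-- (A duplicate-free, so each edge is counted once).
PD : ∀ {n m} → List (Species n m) → ℕ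
PD A = sum (map weight A)

budget : ℕ → ℕ → ℕ
budget n m = 2 * n + m + 1

module Submission where

-- Only the edge (r , t) has positive weight, so PD(A) > 0 means t ∈ A, and
-- then viability forces every clause species c_i and every c_x into A, and
-- each c_x needs one of its literals x, x̄ in A.  These 1 + m + n species
-- together with one literal per variable already exhaust the budget, so a
-- viable set within budget contains at most n literals: exactly one per
-- variable.  This literal choice is an assignment, and viability of c_i
-- says it satisfies clause i.  Conversely a satisfying assignment α yields
-- the viable set  t, c_1..c_m, c_x (all x), and the literal of x made true
-- by α.

open import Defs
open import Data.Nat using (ℕ; zero; suc; _+_; _*_; _≤_; _<_; z≤n; s≤s; s≤s⁻¹)
open import Data.Nat.Properties using (≤-reflexive; +-cancelˡ-≤; 1+n≰n; module ≤-Reasoning)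
open import Data.Nat.Tactic.RingSolver using (solve-∀)
open import Data.Bool using (Bool; true; false; _≟_)
open import Data.Fin using (Fin; zero)
open import Data.Fin.Properties using (injective⇒≤)
open import Data.List using (List; _∷_; _++_; map; length; lookup; allFin)
open import Data.List.Properties using (length-map; length-++; length-tabulate)
open import Data.List.Relation.Unary.All as All using (All)
open import Data.List.Relation.Unary.AllPairs using (_∷_)
open import Data.List.Relation.Unary.Any using (here; there; index)
open import Data.List.Relation.Unary.Unique.Propositional using (Unique)
open import Data.List.Relation.Unary.Unique.Propositional.Properties using (++⁺; map⁺; allFin⁺)
open import Data.List.Relation.Binary.Subset.Propositional using (_⊆_)
open import Data.List.Relation.Binary.Disjoint.Propositional using (Disjoint)
open import Data.List.Membership.Propositional using (_∈_)
open import Data.List.Membership.Propositional.Properties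
  using (∈-map⁺; ∈-map⁻; ∈-++⁺ˡ; ∈-++⁺ʳ; ∈-++⁻; ∈-allFin; ∈-lookup)
import Data.List.Membership.Setoid.Properties as SetoidMembership
open import Data.Vec as Vec using (Vec)
import Data.Vec.Membership.Propositional as VecMem
import Data.Vec.Relation.Unary.Any as VecAny
open import Data.Empty using (⊥-elim)
open import Data.Sum using (_⊎_; inj₁; inj₂)
open import Data.Product using (_×_; _,_; proj₁; proj₂; ∃-syntax)
open import Function using (_∘_)
open import Function.Bundles using (_⇔_; mk⇔)
open import Function.Definitions using (Injective)
open import Relation.Nullary using (¬_; yes; no)
open import Relation.Binary.PropositionalEquality
  using (_≡_; refl; sym; trans; cong; cong₂; subst; setoid)

module _ {a} {X : Set a} where

  lookup-injective : ∀ {xs : List X} → Unique xs → Injective _≡_ _≡_ (lookup xs)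
  lookup-injective {_ ∷ _} (_ ∷ _) {zero} {zero} _ = refl
  lookup-injective {_ ∷ _} (x∉ ∷ _) {zero} {Fin.suc j} eq = ⊥-elim (All.lookup x∉ (∈-lookup j) eq)
  lookup-injective {_ ∷ _} (x∉ ∷ _) {Fin.suc i} {zero} eq = ⊥-elim (All.lookup x∉ (∈-lookup i) (sym eq))
  lookup-injective {_ ∷ _} (_ ∷ u) {Fin.suc i} {Fin.suc j} eq = cong Fin.suc (lookup-injective u eq)

  -- Pigeonhole for lists: a duplicate-free list is no longer than any list
  -- containing all of its entries (position in ys is an injection).
  unique-⊆⇒length≤ : ∀ {xs ys : List X} → Unique xs → xs ⊆ ys → length xs ≤ length ys
  unique-⊆⇒length≤ {xs} {ys} u xs⊆ys = injective⇒≤ {f = position} position-injective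
    where
    position : Fin (length xs) → Fin (length ys)
    position i = index (xs⊆ys (∈-lookup i))
    position-injective : Injective _≡_ _≡_ position
    position-injective {i} {j} eq = lookup-injective u
      (SetoidMembership.index-injective (setoid X) (xs⊆ys (∈-lookup i)) (xs⊆ys (∈-lookup j)) eq)

head∈ : ∀ {a} {X : Set a} {k} (v : Vec X (suc k)) → VecMem._∈_ (Vec.head v) v
head∈ (x Vec.∷ _) = VecAny.here refl

module _ {n m : ℕ} where

  litOf : Fin n → Bool → Species n m
  litOf x true  = pos x
  litOf x false = neg x

  litOf-injective : ∀ {x y b c} → litOf x b ≡ litOf y c → x ≡ y × b ≡ c
  litOf-injective {b = true}  {true}  refl = refl , refl
  litOf-injective {b = false} {false} refl = refl , refl

  data IsLiteral : Species n m → Set where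
    pos : ∀ x → IsLiteral (pos x)
    neg : ∀ x → IsLiteral (neg x)

  litOf-IsLiteral : ∀ x b → IsLiteral (litOf x b)
  litOf-IsLiteral x true  = pos x
  litOf-IsLiteral x false = neg x

  lits : (Fin n → Bool) → List (Species n m)
  lits α = map (λ x → litOf x (α x)) (allFin n)

  lits-unique : ∀ α → Unique (lits α)
  lits-unique α = map⁺ (proj₁ ∘ litOf-injective) (allFin⁺ n)

  lits-literal : ∀ α → All IsLiteral (lits α)
  lits-literal α = All.tabulate λ s∈ → literal-of (∈-map⁻ _ s∈)
    where
    literal-of : ∀ {s} → ∃[ x ] (x ∈ allFin n × s ≡ litOf x (α x)) → IsLiteral s
    literal-of (x , _ , refl) = litOf-IsLiteral x (α x)

  length-lits : ∀ α → length (lits α) ≡ n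
  length-lits α = trans (length-map _ (allFin n)) (length-tabulate {n = n} (λ x → x))

  lit∈lits : ∀ α x → litOf x (α x) ∈ lits α
  lit∈lits α x = ∈-map⁺ _ (∈-allFin x)

  lits⊆ : ∀ {α A} → (∀ x → litOf x (α x) ∈ A) → lits α ⊆ A
  lits⊆ {α} lit∈A p with ∈-map⁻ (λ x → litOf x (α x)) p
  ... | x , _ , refl = lit∈A x

  clauses : List (Species n m)
  clauses = map clause (allFin m)

  cvars : List (Species n m)
  cvars = map cvar (allFin n)

  -- The species forced by t, followed by a list L of literals.
  layout : List (Species n m) → List (Species n m)
  layout L = t ∷ clauses ++ cvars ++ L

  length-layout : ∀ L → length (layout L) ≡ suc (m + (n + length L))
  length-layout L = cong suc (trans (length-++ clauses)
    (cong₂ _+_ (count clause) (trans (length-++ cvars) (cong (_+ length L) (count cvar)))))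
    where
    count : ∀ {k} (f : Fin k → Species n m) → length (map f (allFin k)) ≡ k
    count {k} f = trans (length-map f (allFin k)) (length-tabulate {n = k} (λ x → x))

  -- The four blocks of a layout are pairwise disjoint, so it is
  -- duplicate-free as soon as the literal block is.
  layout-unique : ∀ {L} → Unique L → All IsLiteral L → Unique (layout L)
  layout-unique {L} uL litL =
    All.tabulate t∉ ∷ ++⁺ (map⁺ clause-inj (allFin⁺ m)) (++⁺ (map⁺ cvar-inj (allFin⁺ n)) uL cvars#L) clauses#rest
    where
    clause-inj : ∀ {i j} → clause {n} {m} i ≡ clause j → i ≡ j
    clause-inj refl = refl
    cvar-inj : ∀ {x y} → cvar {n} {m} x ≡ cvar y → x ≡ y
    cvar-inj refl = refl
    cvar∉L : ∀ {x} → ¬ cvar x ∈ L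
    cvar∉L q with All.lookup litL q
    ... | ()
    cvars#L : Disjoint cvars L
    cvars#L (p , q) with ∈-map⁻ cvar p
    ... | _ , _ , refl = cvar∉L q
    clauses#rest : Disjoint clauses (cvars ++ L)
    clauses#rest (p , q) with ∈-map⁻ clause p | ∈-++⁻ cvars q
    ... | _ , _ , refl | inj₁ r with ∈-map⁻ cvar r
    ...   | _ , _ , ()
    clauses#rest (p , q) | _ , _ , refl | inj₂ r with All.lookup litL r
    ...   | ()
    t∉ : ∀ {s} → s ∈ clauses ++ cvars ++ L → ¬ t ≡ s
    t∉ q refl with ∈-++⁻ clauses q
    ... | inj₁ r with ∈-map⁻ clause r
    ...   | _ , _ , ()
    t∉ q refl | inj₂ r with ∈-++⁻ cvars r
    ... | inj₁ u with ∈-map⁻ cvar u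
    ...   | _ , _ , ()
    t∉ q refl | inj₂ r | inj₂ u with All.lookup litL u
    ...   | ()

  clause∈layout : ∀ L i → clause i ∈ layout L
  clause∈layout L i = there (∈-++⁺ˡ (∈-map⁺ clause (∈-allFin i)))

  cvar∈layout : ∀ L x → cvar x ∈ layout L
  cvar∈layout L x = there (∈-++⁺ʳ clauses (∈-++⁺ˡ (∈-map⁺ cvar (∈-allFin x))))

  L⊆layout : ∀ L → L ⊆ layout L
  L⊆layout L p = there (∈-++⁺ʳ clauses (∈-++⁺ʳ cvars p))

  layout⊆ : ∀ {L A} → t ∈ A → (∀ i → clause i ∈ A) → (∀ x → cvar x ∈ A) → L ⊆ A → layout L ⊆ A
  layout⊆ t∈A _ _ _ (here refl) = t∈A
  layout⊆ t∈A clause∈A cvar∈A L⊆A (there p) with ∈-++⁻ clauses p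
  ... | inj₁ q with ∈-map⁻ clause q
  ...   | i , _ , refl = clause∈A i
  layout⊆ t∈A clause∈A cvar∈A L⊆A (there p) | inj₂ q with ∈-++⁻ cvars q
  ... | inj₁ r with ∈-map⁻ cvar r
  ...   | x , _ , refl = cvar∈A x
  layout⊆ t∈A clause∈A cvar∈A L⊆A (there p) | inj₂ q | inj₂ r = L⊆A r

  -- Only t has a positively weighted edge in the star tree.
  PD-positive⇒t∈ : ∀ (A : List (Species n m)) → 0 < PD A → t ∈ A
  PD-positive⇒t∈ (t ∷ A)        _  = here refl
  PD-positive⇒t∈ (clause _ ∷ A) pd = there (PD-positive⇒t∈ A pd)
  PD-positive⇒t∈ (pos _ ∷ A)    pd = there (PD-positive⇒t∈ A pd)
  PD-positive⇒t∈ (neg _ ∷ A)    pd = there (PD-positive⇒t∈ A pd)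
  PD-positive⇒t∈ (cvar _ ∷ A)   pd = there (PD-positive⇒t∈ A pd)

  -- k is the size of a layout with exactly n literals.
  budget-layout : budget n m ≡ suc (m + (n + n))
  budget-layout = lemma m n
    where
    lemma : ∀ a b → 2 * b + a + 1 ≡ suc (a + (b + b))
    lemma = solve-∀

  length-layout-lits : ∀ α → length (layout (lits α)) ≡ budget n m
  length-layout-lits α = trans (length-layout (lits α))
    (trans (cong (λ k → suc (m + (n + k))) (length-lits α)) (sym budget-layout))

-- t satisfies viability condition (i) once all its out-neighbours are
-- present (it is a sink exactly when there are no clauses and no variables).
t-supported : ∀ {n m} (φ : CNF3 n m) {A} → (∀ i → clause i ∈ A) → (∀ x → cvar x ∈ A) →
              Sink φ t ⊎ ∃[ s ] (s ∈ A × Edge φ t s)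
t-supported {m = suc _} φ clause∈A _ = inj₂ (_ , clause∈A zero , t-ci zero)
t-supported {n = suc _} {m = zero} φ _ cvar∈A = inj₂ (_ , cvar∈A zero , t-cx zero)
t-supported {n = zero}  {m = zero} φ _ _ = inj₁ λ { _ (t-ci ()) ; _ (t-cx ()) }

module FoodWeb {n m : ℕ} (φ : CNF3 n m) where

  Satisfies : (Fin n → Bool) → Set
  Satisfies α = ∀ i → ∃[ ℓ ] (VecMem._∈_ ℓ (φ i) × α (proj₁ ℓ) ≡ proj₂ ℓ)

  Supported : List (Species n m) → Species n m → Set
  Supported A s = Sink φ s ⊎ ∃[ s' ] (s' ∈ A × Edge φ s s')

  clause-edge : ∀ {i x b} → VecMem._∈_ (x , b) (φ i) → Edge φ (clause i) (litOf x b)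
  clause-edge {b = true}  = ci-pos _ _
  clause-edge {b = false} = ci-neg _ _

  clause-edge⁻¹ : ∀ {i s} → Edge φ (clause i) s → ∃[ ℓ ] (VecMem._∈_ ℓ (φ i) × s ≡ litOf (proj₁ ℓ) (proj₂ ℓ))
  clause-edge⁻¹ (ci-pos _ x p) = (x , true)  , p , refl
  clause-edge⁻¹ (ci-neg _ x p) = (x , false) , p , refl

  cvar-edge : ∀ x b → Edge φ (cvar x) (litOf x b)
  cvar-edge x true  = cx-pos x
  cvar-edge x false = cx-neg x

  cvar-edge⁻¹ : ∀ {x s} → Edge φ (cvar x) s → ∃[ b ] s ≡ litOf x b
  cvar-edge⁻¹ (cx-pos _) = true  , refl
  cvar-edge⁻¹ (cx-neg _) = false , refl

  -- Every clause has three literals, hence an outgoing edge.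
  clause-not-sink : ∀ i → ¬ Sink φ (clause i)
  clause-not-sink i sink = sink _ (clause-edge (head∈ (φ i)))

  satisfying⇒viable : ∀ α → Satisfies α → Viable φ (layout (lits α))
  satisfying⇒viable α sat = (λ s _ → supported s) , t-closed
    where
    A = layout (lits α)
    supported : ∀ s → Supported A s
    supported t          = t-supported φ (clause∈layout _) (cvar∈layout _)
    supported (clause i) with sat i
    ... | (x , _) , x∈φi , refl = inj₂ (_ , L⊆layout _ (lit∈lits α x) , clause-edge x∈φi)
    supported (cvar x)   = inj₂ (_ , L⊆layout _ (lit∈lits α x) , cvar-edge x (α x))
    supported (pos x)    = inj₁ λ _ ()
    supported (neg x)    = inj₁ λ _ ()
    t-closed : t ∈ A → ∀ s → Edge φ t s → s ∈ A
    t-closed _ _ (t-ci i) = clause∈layout _ i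
    t-closed _ _ (t-cx x) = cvar∈layout _ x

  module Backward {A : List (Species n m)} (viable : Viable φ A)
                  (within : length A ≤ budget n m) (t∈A : t ∈ A) where

    clause∈A : ∀ i → clause i ∈ A
    clause∈A i = proj₂ viable t∈A _ (t-ci i)

    cvar∈A : ∀ x → cvar x ∈ A
    cvar∈A x = proj₂ viable t∈A _ (t-cx x)

    -- The forced species use up all but n places, leaving room for at most n literals.
    literal-bound : ∀ {L} → Unique L → All IsLiteral L → L ⊆ A → length L ≤ n
    literal-bound {L} uL litL L⊆A = +-cancelˡ-≤ n _ _ (+-cancelˡ-≤ m _ _ (s≤s⁻¹ bound))
      where
      open ≤-Reasoning
      bound : suc (m + (n + length L)) ≤ suc (m + (n + n))
      bound = begin
        suc (m + (n + length L)) ≡⟨ length-layout {n} {m} L ⟨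
        length (layout L)        ≤⟨ unique-⊆⇒length≤ (layout-unique uL litL) (layout⊆ t∈A clause∈A cvar∈A L⊆A) ⟩
        length A                 ≤⟨ within ⟩
        budget n m               ≡⟨ budget-layout {n} {m} ⟩
        suc (m + (n + n))        ∎

    -- Each c_x has an out-neighbour in A, a literal of x: this choice is the assignment.
    choice : ∀ x → ∃[ b ] litOf x b ∈ A
    choice x with proj₁ viable (cvar x) (cvar∈A x)
    ... | inj₁ sink = ⊥-elim (sink _ (cvar-edge x true))
    ... | inj₂ (_ , s∈A , e) with cvar-edge⁻¹ e
    ...   | b , refl = b , s∈A

    α : Fin n → Bool
    α x = proj₁ (choice x)

    -- Within budget, every literal in A is a chosen one: a further literal
    -- would give n + 1 literals in A.
    consistent : ∀ {x b} → litOf x b ∈ A → α x ≡ b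
    consistent {x} {b} lit∈A with α x ≟ b
    ... | yes αx≡b = αx≡b
    ... | no αx≢b = ⊥-elim (1+n≰n (subst-length (literal-bound uL litL L⊆A)))
      where
      L = litOf x b ∷ lits α
      fresh : ∀ {s} → s ∈ lits α → ¬ litOf x b ≡ s
      fresh p eq with ∈-map⁻ (λ y → litOf y (α y)) p
      ... | y , _ , refl with litOf-injective eq
      ...   | refl , b≡αx = αx≢b (sym b≡αx)
      uL : Unique L
      uL = All.tabulate fresh ∷ lits-unique α
      litL : All IsLiteral L
      litL = litOf-IsLiteral x b All.∷ lits-literal α
      L⊆A : L ⊆ A
      L⊆A (here refl) = lit∈A
      L⊆A (there p)   = lits⊆ (λ y → proj₂ (choice y)) p
      subst-length : length L ≤ n → suc n ≤ n
      subst-length = subst (_≤ n) (cong suc (length-lits α))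

    -- Viability of c_i yields a literal of clause i in A, which α makes true.
    satisfies : Satisfies α
    satisfies i with proj₁ viable (clause i) (clause∈A i)
    ... | inj₁ sink = ⊥-elim (clause-not-sink i sink)
    ... | inj₂ (_ , s∈A , e) with clause-edge⁻¹ e
    ...   | ℓ , ℓ∈φi , refl = ℓ , ℓ∈φi , consistent s∈A

lemma8 : ∀ {n m : ℕ} (φ : CNF3 n m) →
    Satisfiable φ ⇔
      (∃[ A ] (Unique A × Viable φ A × length A ≤ budget n m × 0 < PD A))
lemma8 {n} {m} φ = mk⇔ forward backward
  where
  open FoodWeb φ
  forward : Satisfiable φ → ∃[ A ] (Unique A × Viable φ A × length A ≤ budget n m × 0 < PD A)
  forward (α , sat) = layout (lits α) , layout-unique (lits-unique α) (lits-literal α) ,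
                      satisfying⇒viable α sat , ≤-reflexive (length-layout-lits α) , s≤s z≤n
  backward : (∃[ A ] (Unique A × Viable φ A × length A ≤ budget n m × 0 < PD A)) → Satisfiable φ
  backward (A , _ , viable , within , pd) = α , satisfies
    where open Backward viable within (PD-positive⇒t∈ A pd)
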